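{- Let $q\ge 1$ be an integer and let $(A,B,C,\mathcal{F})$ be an instance of 3-dimensional matching: $A,B,C$ are pairwise disjoint finite sets with $|A|=2q$ and $|B|=|C|=q$, and $\mathcal{F}\subseteq A\times B\times C$. Fix an integer $\omega\ge 2$. Construct an edge-weighted hypergraph $H$ as follows. The drivers are the elements of $A$, each with capacity $2$; the riders are the elements of $B\cup C$. For every triple $f=(a,b,c)\in\mathcal{F}$, $H$ contains the hyperedges $e(f)=\{a,b,c\}$, $e'(f)=\{a,b\}$ and $e''(f)=\{a,c\}$, each of weight $2$. In addition, for every pair $a\in A$, $b\in B$ such that $\{a,b\}$ is not already an edge, add the edge $\{a,b\}$ with weight $\omega$; and for every pair $a\in A$, $c\in C$ such that $\{a,c\}$ is not already an edge, add the edge $\{a,c\}$ with weight $\omega$. Consider the integer linear program $$\min \sum_{e\in E(H)} w(e)x_e \quad\text{s.t.}\quad \sum_{e\ni a} x_e\le 1\ \ \forall a\in A,\qquad \sum_{e\ni r}x_e=1\ \ \forall r\in B\cup C,\qquad x_e\in\{0,1\}\ \ \forall e\in E(H).$$ Then $\mathcal{F}$ contains $q$ pairwise disjoint triples (a 3-dimensional matching of cardinality $q$) if and only if the optimal objective value of this integer linear program is $2q$.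
   Context: Two triples of $\mathcal{F}$ are disjoint if they share no element. Each hyperedge of $H$ contains exactly one element of $A$ (a driver) and one or two elements of $B\cup C$ (riders). -}

module Defs where

open import Data.Nat using (ℕ; zero; suc; _+_; _*_; _≤_)
open import Data.Bool using (Bool; true; false; if_then_else_; _∨_)
open import Data.Fin using (Fin)
open import Data.List using (List; map; foldr; allFin)
open import Data.Nat.ListAction using (sum)
open import Data.Product using (Σ; _×_; _,_)
open import Relation.Binary.PropositionalEquality using (_≡_; _≢_)
open import Relation.Nullary using (¬_)

Σ[_]_ : (n : ℕ) → (Fin n → ℕ) → ℕ
Σ[ n ] f = sum (map f (allFin n))

Any[_]_ : (n : ℕ) → (Fin n → Bool) → Bool
Any[ n ] f = foldr _∨_ false (map f (allFin n))

⟦_⟧ : Bool → ℕ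
⟦ b ⟧ = if b then 1 else 0

-- An instance of 3DM: A = Fin (2q), B = Fin q, C = Fin q (pairwise disjoint
-- as separate types), F ⊆ A × B × C given as a (decidable) characteristic function.
Family : ℕ → Set
Family q = Fin (2 * q) → Fin q → Fin q → Bool

Triple : ℕ → Set
Triple q = Fin (2 * q) × Fin q × Fin q

Disjoint : ∀ {q} → Triple q → Triple q → Set
Disjoint (a , b , c) (a' , b' , c') = a ≢ a' × b ≢ b' × c ≢ c'

InF : ∀ {q} → Family q → Triple q → Set
InF F (a , b , c) = F a b c ≡ true

HasPerfect3DM : (q : ℕ) → Family q → Set
HasPerfect3DM q F =
  Σ (Fin q → Triple q) λ M →
    ((i : Fin q) → InF F (M i)) ×
    ((i j : Fin q) → i ≢ j → Disjoint (M i) (M j))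

module ILP (q ω : ℕ) (F : Family q) where

  -- weight of the pair edge {a,b}: 2 if it is e'(f) for some f = (a,b,c) ∈ F, else ω
  wB : Fin (2 * q) → Fin q → ℕ
  wB a b = if Any[ q ] (λ c → F a b c) then 2 else ω

  -- weight of the pair edge {a,c}: 2 if it is e''(f) for some f = (a,b,c) ∈ F, else ω
  wC : Fin (2 * q) → Fin q → ℕ
  wC a c = if Any[ q ] (λ b → F a b c) then 2 else ω

  -- 0/1 variables: xT for triple hyperedges {a,b,c}, xB for pairs {a,b}, xC for pairs {a,c}
  record Assignment : Set where
    field
      xT : Fin (2 * q) → Fin q → Fin q → Bool
      xB : Fin (2 * q) → Fin q → Bool
      xC : Fin (2 * q) → Fin q → Bool
  open Assignment public

  cost : Assignment → ℕ
  cost x =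
      Σ[ 2 * q ] (λ a → Σ[ q ] (λ b → Σ[ q ] (λ c → 2 * ⟦ xT x a b c ⟧)))
    + Σ[ 2 * q ] (λ a → Σ[ q ] (λ b → wB a b * ⟦ xB x a b ⟧))
    + Σ[ 2 * q ] (λ a → Σ[ q ] (λ c → wC a c * ⟦ xC x a c ⟧))

  loadA : Assignment → Fin (2 * q) → ℕ
  loadA x a =
      Σ[ q ] (λ b → Σ[ q ] (λ c → ⟦ xT x a b c ⟧))
    + Σ[ q ] (λ b → ⟦ xB x a b ⟧)
    + Σ[ q ] (λ c → ⟦ xC x a c ⟧)

  loadB : Assignment → Fin q → ℕ
  loadB x b =
      Σ[ 2 * q ] (λ a → Σ[ q ] (λ c → ⟦ xT x a b c ⟧))
    + Σ[ 2 * q ] (λ a → ⟦ xB x a b ⟧)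

  loadC : Assignment → Fin q → ℕ
  loadC x c =
      Σ[ 2 * q ] (λ a → Σ[ q ] (λ b → ⟦ xT x a b c ⟧))
    + Σ[ 2 * q ] (λ a → ⟦ xC x a c ⟧)

  -- feasibility: variables only on edges of H, driver constraints ≤ 1, rider constraints = 1
  Feasible : Assignment → Set
  Feasible x =
      (∀ a b c → xT x a b c ≡ true → F a b c ≡ true)
    × (∀ a → loadA x a ≤ 1)
    × (∀ b → loadB x b ≡ 1)
    × (∀ c → loadC x c ≡ 1)

  OptimalValue : ℕ → Set
  OptimalValue v =
      Σ Assignment (λ x → Feasible x × cost x ≡ v)
    × (∀ x → Feasible x → v ≤ cost x)

-- Summing the rider constraints over B and over C gives t + p_B = q and t + p_C = q, where
-- t, p_B, p_C count the chosen triples, {a,b}-edges and {a,c}-edges.  Every edge weighs at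
-- least 2, so the cost is at least 2(t + p_B + p_C) = 2q + p_B + p_C.  Hence a solution of
-- cost 2q uses no pair edges: its triples cover each rider of B exactly once, and the
-- constraints of the drivers and of the riders of C make them pairwise disjoint.
-- Conversely, a perfect matching indexed by its B-coordinates is a solution of cost 2q.
module Submission where

open import Defs
open import Data.Nat.Properties hiding (_≟_)
open import Algebra.Properties.Semiring.Sum Data.Nat.Properties.+-*-semiring
  using (sum-cong-≗; sum-replicate-zero; sum-remove; ∑-distrib-+; ∑-comm; *-distribˡ-sum)
  renaming (sum to ∑)
open import Data.Bool using (Bool; true; false; _∧_; if_then_else_)
open import Data.Bool.Properties using (∧-comm)
open import Data.Fin using (Fin; zero; suc; punchIn; punchOut; _≟_)
open import Data.Fin.Properties using (any?; punchInᵢ≢i; punchIn-punchOut; punchOut-injective; injective⇒≤)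
open import Data.List using (tabulate)
open import Data.List.Properties using (map-tabulate)
import Data.Nat.ListAction as ListAction
open import Data.Nat using (ℕ; zero; suc; _+_; _*_; _≤_; _<_; z≤n; s≤s; _<?_)
open import Data.Product using (∃; ∃₂; _,_; proj₁; proj₂)
open import Data.Nat.Tactic.RingSolver using (solve-∀)
open import Function using (_∘_; id)
open import Function.Bundles using (_⇔_; mk⇔)
open import Function.Definitions using (Injective)
open import Relation.Binary.PropositionalEquality
open import Relation.Nullary using (yes; no; does; contradiction)
open import Relation.Nullary.Decidable using (dec-true; dec-false; decidable-stable)
open import Relation.Unary using (Pred; Decidable)

Σ≡∑ : ∀ n (f : Fin n → ℕ) → Σ[ n ] f ≡ ∑ f
Σ≡∑ n f = trans (cong ListAction.sum (map-tabulate id f)) (sum-tabulate n f)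
  where
  sum-tabulate : ∀ n (f : Fin n → ℕ) → ListAction.sum (tabulate f) ≡ ∑ f
  sum-tabulate zero    f = refl
  sum-tabulate (suc n) f = cong (f zero +_) (sum-tabulate n (f ∘ suc))

module _ {n : ℕ} where

  Σ-cong : {f g : Fin n → ℕ} → (∀ i → f i ≡ g i) → Σ[ n ] f ≡ Σ[ n ] g
  Σ-cong {f} {g} f≗g = trans (Σ≡∑ n f) (trans (sum-cong-≗ f≗g) (sym (Σ≡∑ n g)))

  Σ-const-0 : Σ[ n ] (λ _ → 0) ≡ 0
  Σ-const-0 = trans (Σ≡∑ n (λ _ → 0)) (sum-replicate-zero n)

  Σ-zero : {f : Fin n → ℕ} → (∀ i → f i ≡ 0) → Σ[ n ] f ≡ 0
  Σ-zero f≗0 = trans (Σ-cong f≗0) Σ-const-0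

  Σ-distrib-+ : (f g : Fin n → ℕ) → Σ[ n ] (λ i → f i + g i) ≡ Σ[ n ] f + Σ[ n ] g
  Σ-distrib-+ f g = begin
    Σ[ n ] (λ i → f i + g i) ≡⟨ Σ≡∑ n _ ⟩
    ∑ {n} (λ i → f i + g i)  ≡⟨ ∑-distrib-+ f g ⟩
    ∑ {n} f + ∑ g            ≡⟨ sym (cong₂ _+_ (Σ≡∑ n f) (Σ≡∑ n g)) ⟩
    Σ[ n ] f + Σ[ n ] g      ∎
    where open ≡-Reasoning

  *-distribˡ-Σ : ∀ k (f : Fin n → ℕ) → k * Σ[ n ] f ≡ Σ[ n ] (λ i → k * f i)
  *-distribˡ-Σ k f = begin
    k * Σ[ n ] f             ≡⟨ cong (k *_) (Σ≡∑ n f) ⟩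
    k * ∑ {n} f              ≡⟨ *-distribˡ-sum k f ⟩
    ∑ {n} (λ i → k * f i)    ≡⟨ sym (Σ≡∑ n _) ⟩
    Σ[ n ] (λ i → k * f i)   ∎
    where open ≡-Reasoning

Σ-comm : ∀ {m n} (f : Fin m → Fin n → ℕ) →
         Σ[ m ] (λ i → Σ[ n ] (f i)) ≡ Σ[ n ] (λ j → Σ[ m ] (λ i → f i j))
Σ-comm {m} {n} f = begin
  Σ[ m ] (λ i → Σ[ n ] (f i))           ≡⟨ Σ≡∑ m (λ i → Σ[ n ] (f i)) ⟩
  ∑ {m} (λ i → Σ[ n ] (f i))            ≡⟨ sum-cong-≗ (λ i → Σ≡∑ n (f i)) ⟩
  ∑ {m} (λ i → ∑ {n} (f i))             ≡⟨ ∑-comm f ⟩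
  ∑ {n} (λ j → ∑ {m} (λ i → f i j))     ≡⟨ sum-cong-≗ (λ j → Σ≡∑ m (λ i → f i j)) ⟨
  ∑ {n} (λ j → Σ[ m ] (λ i → f i j))    ≡⟨ Σ≡∑ n (λ j → Σ[ m ] (λ i → f i j)) ⟨
  Σ[ n ] (λ j → Σ[ m ] (λ i → f i j))   ∎
  where open ≡-Reasoning

Σ-remove : ∀ {n} (f : Fin (suc n) → ℕ) i → Σ[ suc n ] f ≡ f i + Σ[ n ] (f ∘ punchIn i)
Σ-remove {n} f i = begin
  Σ[ suc n ] f                   ≡⟨ Σ≡∑ (suc n) f ⟩
  ∑ f                            ≡⟨ sum-remove f ⟩
  f i + ∑ {n} (f ∘ punchIn i)    ≡⟨ cong (f i +_) (Σ≡∑ n (f ∘ punchIn i)) ⟨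
  f i + Σ[ n ] (f ∘ punchIn i)   ∎
  where open ≡-Reasoning

Σ-const-1 : ∀ n → Σ[ n ] (λ _ → 1) ≡ n
Σ-const-1 zero    = refl
Σ-const-1 (suc n) = trans (Σ-remove {n} (λ _ → 1) zero) (cong suc (Σ-const-1 n))

Σ-mono-≤ : ∀ {n} {f g : Fin n → ℕ} → (∀ i → f i ≤ g i) → Σ[ n ] f ≤ Σ[ n ] g
Σ-mono-≤ {zero}          f≤g = z≤n
Σ-mono-≤ {suc n} {f} {g} f≤g = begin
  Σ[ suc n ] f                ≡⟨ Σ-remove f zero ⟩
  f zero + Σ[ n ] (f ∘ suc)   ≤⟨ +-mono-≤ (f≤g zero) (Σ-mono-≤ (f≤g ∘ suc)) ⟩
  g zero + Σ[ n ] (g ∘ suc)   ≡⟨ Σ-remove g zero ⟨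
  Σ[ suc n ] g                ∎
  where open ≤-Reasoning

term≤Σ : ∀ {n} (f : Fin n → ℕ) i → f i ≤ Σ[ n ] f
term≤Σ {suc n} f i = ≤-trans (m≤m+n _ _) (≤-reflexive (sym (Σ-remove f i)))

terms≤Σ : ∀ {n} (f : Fin n → ℕ) {i j} → i ≢ j → f i + f j ≤ Σ[ n ] f
terms≤Σ {suc n} f {i} {j} i≢j = begin
  f i + f j                      ≡⟨ cong (λ k → f i + f k) (punchIn-punchOut i≢j) ⟨
  f i + f (punchIn i k)          ≤⟨ +-monoʳ-≤ (f i) (term≤Σ (f ∘ punchIn i) k) ⟩
  f i + Σ[ n ] (f ∘ punchIn i)   ≡⟨ Σ-remove f i ⟨
  Σ[ suc n ] f                   ∎
  where
  open ≤-Reasoning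
  k = punchOut i≢j

Σ-positive : ∀ {n} (f : Fin n → ℕ) → 0 < Σ[ n ] f → ∃ λ i → 0 < f i
Σ-positive f 0<Σf with any? (λ i → 0 <? f i)
... | yes witness = witness
... | no  ∄      = contradiction (Σ-zero (λ i → n≤0⇒n≡0 (≮⇒≥ (λ 0<fi → ∄ (i , 0<fi))))) (>⇒≢ 0<Σf)

Σ-does≡1 : ∀ {n p} {P : Pred (Fin n) p} (P? : Decidable P) {i} → P i → (∀ {j} → P j → j ≡ i) →
           Σ[ n ] (λ j → ⟦ does (P? j) ⟧) ≡ 1
Σ-does≡1 {suc n} P? {i} Pi unique = begin
  Σ[ suc n ] (λ j → ⟦ does (P? j) ⟧)                          ≡⟨ Σ-remove _ i ⟩
  ⟦ does (P? i) ⟧ + Σ[ n ] (λ k → ⟦ does (P? (punchIn i k)) ⟧) ≡⟨ cong₂ _+_ P-at-i ¬P-elsewhere ⟩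
  1                                                           ∎
  where
  open ≡-Reasoning
  P-at-i = cong ⟦_⟧ (dec-true (P? i) Pi)
  ¬P-elsewhere = Σ-zero (λ k → cong ⟦_⟧ (dec-false (P? _) (punchInᵢ≢i i k ∘ unique)))

Σ-does≤1 : ∀ {n p} {P : Pred (Fin n) p} (P? : Decidable P) → (∀ {i j} → P i → P j → i ≡ j) →
              Σ[ n ] (λ j → ⟦ does (P? j) ⟧) ≤ 1
Σ-does≤1 P? unique with any? P?
... | yes (i , Pi) = ≤-reflexive (Σ-does≡1 P? Pi (λ Pj → unique Pj Pi))
... | no  ∄        = ≤-trans (≤-reflexive (Σ-zero (λ j → cong ⟦_⟧ (dec-false (P? j) (λ Pj → ∄ (j , Pj)))))) z≤n

Σ²≤1⇒sameRow : ∀ {m n} (f : Fin m → Fin n → ℕ) → Σ[ m ] (λ i → Σ[ n ] (f i)) ≤ 1 →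
               ∀ {i i' j j'} → 0 < f i j → 0 < f i' j' → i ≡ i'
Σ²≤1⇒sameRow {m} {n} f Σ²f≤1 {i} {i'} {j} {j'} 0<fij 0<fi'j' = decidable-stable (i ≟ i') λ i≢i' →
  contradiction (≤-trans (+-mono-≤ (row-positive 0<fij) (row-positive 0<fi'j'))
                         (≤-trans (terms≤Σ (λ k → Σ[ n ] (f k)) i≢i') Σ²f≤1))
                λ { (s≤s ()) }
  where
  row-positive : ∀ {k l} → 0 < f k l → 0 < Σ[ n ] (f k)
  row-positive {k} {l} 0<fkl = ≤-trans 0<fkl (term≤Σ (f k) l)

⟦⟧-positive⇒true : ∀ {b} → 0 < ⟦ b ⟧ → b ≡ true
⟦⟧-positive⇒true {true} _ = refl

true⇒⟦⟧-positive : ∀ {b} → b ≡ true → 0 < ⟦ b ⟧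
true⇒⟦⟧-positive refl = ≤-refl

Σ-∧-indicator : ∀ {n} p (i : Fin n) → Σ[ n ] (λ j → ⟦ p ∧ does (i ≟ j) ⟧) ≡ ⟦ p ⟧
Σ-∧-indicator true  i = Σ-does≡1 (i ≟_) refl sym
Σ-∧-indicator {n} false i = Σ-const-0 {n}

Σ-indicator-∧ : ∀ {n} (i : Fin n) r → Σ[ n ] (λ j → ⟦ does (i ≟ j) ∧ r ⟧) ≡ ⟦ r ⟧
Σ-indicator-∧ i r = trans (Σ-cong (λ j → cong ⟦_⟧ (∧-comm (does (i ≟ j)) r))) (Σ-∧-indicator r i)

injective⇒surjective : ∀ {n} {f : Fin n → Fin n} → Injective _≡_ _≡_ f → ∀ y → ∃ λ x → f x ≡ y
injective⇒surjective {suc n} {f} f-inj y with any? (λ x → f x ≟ y)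
... | yes preimage = preimage
... | no  ∄        = contradiction (injective⇒≤ punchOut∘f-injective) 1+n≰n
  where
  y≢f : ∀ x → y ≢ f x
  y≢f x y≡fx = ∄ (x , sym y≡fx)
  punchOut∘f-injective : Injective _≡_ _≡_ (λ x → punchOut (y≢f x))
  punchOut∘f-injective = f-inj ∘ punchOut-injective (y≢f _) (y≢f _)

pairwise-distinct⇒injective : ∀ {n} {A : Set} {g : Fin n → A} → (∀ i j → i ≢ j → g i ≢ g j) →
                              Injective _≡_ _≡_ g
pairwise-distinct⇒injective distinct {i} {j} gi≡gj = decidable-stable (i ≟ j) (λ i≢j → distinct i j i≢j gi≡gj)

-- A perfect matching indexed by B: rider b shares its triple with driver b and partner b.
record MatchingByB {q : ℕ} (F : Family q) : Set where
  field
    driver            : Fin q → Fin (2 * q)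
    partner           : Fin q → Fin q
    driver-injective  : Injective _≡_ _≡_ driver
    partner-injective : Injective _≡_ _≡_ partner
    inF               : ∀ b → F (driver b) b (partner b) ≡ true

perfect3DM⇒matchingByB : ∀ {q} {F : Family q} → HasPerfect3DM q F → MatchingByB F
perfect3DM⇒matchingByB {q} {F} (M , inM , disjoint) = record
  { driver            = proj₁ ∘ M ∘ index
  ; partner           = proj₂ ∘ proj₂ ∘ M ∘ index
  ; driver-injective  = pairwise-distinct⇒injective (λ b b' b≢b' → proj₁ (disjoint′ b≢b'))
  ; partner-injective = pairwise-distinct⇒injective (λ b b' b≢b' → proj₂ (proj₂ (disjoint′ b≢b')))
  ; inF               = λ b → subst (λ r → F (proj₁ (M (index b))) r (proj₂ (proj₂ (M (index b)))) ≡ true)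
                                  (index-correct b) (inM (index b))
  }
  where
  B-coord : Fin q → Fin q
  B-coord = proj₁ ∘ proj₂ ∘ M
  B-coord-surjective : ∀ b → ∃ λ i → B-coord i ≡ b
  B-coord-surjective = injective⇒surjective
    (pairwise-distinct⇒injective (λ i j i≢j → proj₁ (proj₂ (disjoint i j i≢j))))
  index : Fin q → Fin q
  index b = proj₁ (B-coord-surjective b)
  index-correct : ∀ b → B-coord (index b) ≡ b
  index-correct b = proj₂ (B-coord-surjective b)
  disjoint′ : ∀ {b b'} → b ≢ b' → Disjoint (M (index b)) (M (index b'))
  disjoint′ {b} {b'} b≢b' = disjoint (index b) (index b') λ e →
    b≢b' (trans (sym (index-correct b)) (trans (cong B-coord e) (index-correct b')))

module _ (q ω : ℕ) (F : Family q) where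
  open ILP q ω F

  triples pairsB pairsC : Assignment → ℕ
  triples x = Σ[ 2 * q ] (λ a → Σ[ q ] (λ b → Σ[ q ] (λ c → ⟦ xT x a b c ⟧)))
  pairsB  x = Σ[ 2 * q ] (λ a → Σ[ q ] (λ b → ⟦ xB x a b ⟧))
  pairsC  x = Σ[ 2 * q ] (λ a → Σ[ q ] (λ c → ⟦ xC x a c ⟧))

  2*triples≡tripleCost : ∀ x → 2 * triples x ≡ Σ[ 2 * q ] (λ a → Σ[ q ] (λ b → Σ[ q ] (λ c → 2 * ⟦ xT x a b c ⟧)))
  2*triples≡tripleCost x = begin
    2 * triples x
      ≡⟨ *-distribˡ-Σ 2 (λ a → Σ[ q ] (λ b → Σ[ q ] (λ c → ⟦ xT x a b c ⟧))) ⟩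
    Σ[ 2 * q ] (λ a → 2 * Σ[ q ] (λ b → Σ[ q ] (λ c → ⟦ xT x a b c ⟧)))
      ≡⟨ Σ-cong (λ a → *-distribˡ-Σ 2 (λ b → Σ[ q ] (λ c → ⟦ xT x a b c ⟧))) ⟩
    Σ[ 2 * q ] (λ a → Σ[ q ] (λ b → 2 * Σ[ q ] (λ c → ⟦ xT x a b c ⟧)))
      ≡⟨ Σ-cong (λ a → Σ-cong (λ b → *-distribˡ-Σ 2 (λ c → ⟦ xT x a b c ⟧))) ⟩
    Σ[ 2 * q ] (λ a → Σ[ q ] (λ b → Σ[ q ] (λ c → 2 * ⟦ xT x a b c ⟧))) ∎
    where open ≡-Reasoning

  pairCost≥ : (w : Fin (2 * q) → Fin q → ℕ) → (∀ a r → 2 ≤ w a r) → (y : Fin (2 * q) → Fin q → Bool) →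
              2 * Σ[ 2 * q ] (λ a → Σ[ q ] (λ r → ⟦ y a r ⟧)) ≤ Σ[ 2 * q ] (λ a → Σ[ q ] (λ r → w a r * ⟦ y a r ⟧))
  pairCost≥ w 2≤w y = begin
    2 * Σ[ 2 * q ] (λ a → Σ[ q ] (λ r → ⟦ y a r ⟧))       ≡⟨ *-distribˡ-Σ 2 (λ a → Σ[ q ] (λ r → ⟦ y a r ⟧)) ⟩
    Σ[ 2 * q ] (λ a → 2 * Σ[ q ] (λ r → ⟦ y a r ⟧))       ≡⟨ Σ-cong (λ a → *-distribˡ-Σ 2 (λ r → ⟦ y a r ⟧)) ⟩
    Σ[ 2 * q ] (λ a → Σ[ q ] (λ r → 2 * ⟦ y a r ⟧))       ≤⟨ Σ-mono-≤ (λ a → Σ-mono-≤ (λ r → *-monoˡ-≤ ⟦ y a r ⟧ (2≤w a r))) ⟩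
    Σ[ 2 * q ] (λ a → Σ[ q ] (λ r → w a r * ⟦ y a r ⟧))   ∎
    where open ≤-Reasoning

  cost≥2*selected : 2 ≤ ω → ∀ x → 2 * triples x + 2 * pairsB x + 2 * pairsC x ≤ cost x
  cost≥2*selected 2≤ω x =
    +-mono-≤ (+-mono-≤ (≤-reflexive (2*triples≡tripleCost x)) (pairCost≥ wB (λ _ _ → 2≤weight) (xB x)))
             (pairCost≥ wC (λ _ _ → 2≤weight) (xC x))
    where
    2≤weight : ∀ {p} → 2 ≤ (if p then 2 else ω)
    2≤weight {true}  = ≤-refl
    2≤weight {false} = 2≤ω

  triples+pairsB≡q : ∀ x → (∀ b → loadB x b ≡ 1) → triples x + pairsB x ≡ q
  triples+pairsB≡q x riders = begin
    triples x + pairsB x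
      ≡⟨ cong₂ _+_ (Σ-comm (λ a b → Σ[ q ] (λ c → ⟦ xT x a b c ⟧))) (Σ-comm (λ a b → ⟦ xB x a b ⟧)) ⟩
    Σ[ q ] byB-triples + Σ[ q ] byB-pairs      ≡⟨ Σ-distrib-+ byB-triples byB-pairs ⟨
    Σ[ q ] (loadB x)                           ≡⟨ Σ-cong riders ⟩
    Σ[ q ] (λ _ → 1)                           ≡⟨ Σ-const-1 q ⟩
    q                                          ∎
    where
    open ≡-Reasoning
    byB-triples byB-pairs : Fin q → ℕ
    byB-triples b = Σ[ 2 * q ] (λ a → Σ[ q ] (λ c → ⟦ xT x a b c ⟧))
    byB-pairs   b = Σ[ 2 * q ] (λ a → ⟦ xB x a b ⟧)

  triples+pairsC≡q : ∀ x → (∀ c → loadC x c ≡ 1) → triples x + pairsC x ≡ q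
  triples+pairsC≡q x riders = begin
    triples x + pairsC x
      ≡⟨ cong (_+ pairsC x) (Σ-cong (λ a → Σ-comm (λ b c → ⟦ xT x a b c ⟧))) ⟩
    Σ[ 2 * q ] (λ a → Σ[ q ] (λ c → Σ[ q ] (λ b → ⟦ xT x a b c ⟧))) + pairsC x
      ≡⟨ cong₂ _+_ (Σ-comm (λ a c → Σ[ q ] (λ b → ⟦ xT x a b c ⟧))) (Σ-comm (λ a c → ⟦ xC x a c ⟧)) ⟩
    Σ[ q ] byC-triples + Σ[ q ] byC-pairs      ≡⟨ Σ-distrib-+ byC-triples byC-pairs ⟨
    Σ[ q ] (loadC x)                           ≡⟨ Σ-cong riders ⟩
    Σ[ q ] (λ _ → 1)                           ≡⟨ Σ-const-1 q ⟩
    q                                          ∎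
    where
    open ≡-Reasoning
    byC-triples byC-pairs : Fin q → ℕ
    byC-triples c = Σ[ 2 * q ] (λ a → Σ[ q ] (λ b → ⟦ xT x a b c ⟧))
    byC-pairs   c = Σ[ 2 * q ] (λ a → ⟦ xC x a c ⟧)

  feasible⇒cost≥2*selected : 2 ≤ ω → ∀ x → Feasible x → 2 * q + (pairsB x + pairsC x) ≤ cost x
  feasible⇒cost≥2*selected 2≤ω x (_ , _ , ridersB , ridersC) = begin
    2 * q + (pB + pC)                            ≡⟨ cong₂ (λ u v → u + (v + 0) + (pB + pC)) (triples+pairsB≡q x ridersB) (triples+pairsC≡q x ridersC) ⟨
    (t + pB) + ((t + pC) + 0) + (pB + pC)        ≡⟨ regroup t pB pC ⟩
    2 * t + 2 * pB + 2 * pC                      ≤⟨ cost≥2*selected 2≤ω x ⟩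
    cost x                                       ∎
    where
    open ≤-Reasoning
    t = triples x
    pB = pairsB x
    pC = pairsC x
    regroup : ∀ t b c → (t + b) + ((t + c) + 0) + (b + c) ≡ 2 * t + 2 * b + 2 * c
    regroup = solve-∀

  feasible⇒cost≥2q : 2 ≤ ω → ∀ x → Feasible x → 2 * q ≤ cost x
  feasible⇒cost≥2q 2≤ω x fx = ≤-trans (m≤m+n _ _) (feasible⇒cost≥2*selected 2≤ω x fx)

  cost≡2q⇒no-pairsB : 2 ≤ ω → ∀ x → Feasible x → cost x ≡ 2 * q → pairsB x ≡ 0
  cost≡2q⇒no-pairsB 2≤ω x fx cost≡2q = n≤0⇒n≡0 (≤-trans (m≤m+n _ _) (+-cancelˡ-≤ (2 * q) _ 0 (begin
    2 * q + (pairsB x + pairsC x)   ≤⟨ feasible⇒cost≥2*selected 2≤ω x fx ⟩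
    cost x                          ≡⟨ cost≡2q ⟩
    2 * q                           ≡⟨ +-identityʳ (2 * q) ⟨
    2 * q + 0                       ∎)))
    where open ≤-Reasoning

  no-pairsB⇒triple-cover : ∀ x → Feasible x → pairsB x ≡ 0 → ∀ b → ∃₂ λ a c → xT x a b c ≡ true
  no-pairsB⇒triple-cover x (_ , _ , ridersB , _) no-pairs b =
    let a , 0<row   = Σ-positive (λ a → Σ[ q ] (λ c → ⟦ xT x a b c ⟧)) (≤-reflexive (sym covered-by-triples))
        c , 0<entry = Σ-positive (λ c → ⟦ xT x a b c ⟧) 0<row
    in  a , c , ⟦⟧-positive⇒true 0<entry
    where
    pairs-at-b≡0 : Σ[ 2 * q ] (λ a → ⟦ xB x a b ⟧) ≡ 0
    pairs-at-b≡0 = n≤0⇒n≡0 (begin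
      Σ[ 2 * q ] (λ a → ⟦ xB x a b ⟧)                   ≤⟨ term≤Σ (λ b → Σ[ 2 * q ] (λ a → ⟦ xB x a b ⟧)) b ⟩
      Σ[ q ] (λ b → Σ[ 2 * q ] (λ a → ⟦ xB x a b ⟧))    ≡⟨ Σ-comm (λ a b → ⟦ xB x a b ⟧) ⟨
      pairsB x                                          ≡⟨ no-pairs ⟩
      0                                                 ∎)
      where open ≤-Reasoning
    covered-by-triples : Σ[ 2 * q ] (λ a → Σ[ q ] (λ c → ⟦ xT x a b c ⟧)) ≡ 1
    covered-by-triples = begin
      triples-at-b                                      ≡⟨ +-identityʳ triples-at-b ⟨
      triples-at-b + 0                                  ≡⟨ cong (triples-at-b +_) pairs-at-b≡0 ⟨
      loadB x b                                         ≡⟨ ridersB b ⟩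
      1                                                 ∎
      where
      open ≡-Reasoning
      triples-at-b = Σ[ 2 * q ] (λ a → Σ[ q ] (λ c → ⟦ xT x a b c ⟧))

  optimal⇒perfect3DM : 2 ≤ ω → OptimalValue (2 * q) → HasPerfect3DM q F
  optimal⇒perfect3DM 2≤ω ((x , fx@(inH , drivers , _ , ridersC) , cost≡2q) , _) = M , inF , disjoint
    where
    cover = no-pairsB⇒triple-cover x fx (cost≡2q⇒no-pairsB 2≤ω x fx cost≡2q)
    driver : Fin q → Fin (2 * q)
    driver b = proj₁ (cover b)
    partner : Fin q → Fin q
    partner b = proj₁ (proj₂ (cover b))
    chosen : ∀ b → xT x (driver b) b (partner b) ≡ true
    chosen b = proj₂ (proj₂ (cover b))
    M : Fin q → Triple q
    M b = driver b , b , partner b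
    inF : ∀ b → InF F (M b)
    inF b = inH _ _ _ (chosen b)
    driver-load≤1 : ∀ a → Σ[ q ] (λ b → Σ[ q ] (λ c → ⟦ xT x a b c ⟧)) ≤ 1
    driver-load≤1 a = ≤-trans (≤-trans (m≤m+n _ _) (m≤m+n _ _)) (drivers a)
    partner-load≤1 : ∀ c → Σ[ q ] (λ b → Σ[ 2 * q ] (λ a → ⟦ xT x a b c ⟧)) ≤ 1
    partner-load≤1 c = ≤-trans (≤-reflexive (sym (Σ-comm (λ a b → ⟦ xT x a b c ⟧))))
                               (≤-trans (m≤m+n _ _) (≤-reflexive (ridersC c)))
    disjoint : ∀ b b' → b ≢ b' → Disjoint (M b) (M b')
    disjoint b b' b≢b' = same-driver-absurd , b≢b' , same-partner-absurd
      where
      same-driver-absurd : driver b ≢ driver b'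
      same-driver-absurd e = b≢b' (Σ²≤1⇒sameRow (λ b c → ⟦ xT x (driver b') b c ⟧) (driver-load≤1 (driver b'))
        (true⇒⟦⟧-positive (subst (λ a → xT x a b (partner b) ≡ true) e (chosen b))) (true⇒⟦⟧-positive (chosen b')))
      same-partner-absurd : partner b ≢ partner b'
      same-partner-absurd e = b≢b' (Σ²≤1⇒sameRow (λ b a → ⟦ xT x a b (partner b') ⟧) (partner-load≤1 (partner b'))
        (true⇒⟦⟧-positive (subst (λ c → xT x (driver b) b c ≡ true) e (chosen b))) (true⇒⟦⟧-positive (chosen b')))

  module _ (m : MatchingByB F) where
    open MatchingByB m

    matchingAssignment : Assignment
    matchingAssignment = record
      { xT = λ a b c → does (driver b ≟ a) ∧ does (partner b ≟ c)
      ; xB = λ _ _ → false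
      ; xC = λ _ _ → false
      }

    private
      x = matchingAssignment

    matching-inH : ∀ a b c → xT x a b c ≡ true → F a b c ≡ true
    matching-inH a b c sel with driver b ≟ a | partner b ≟ c
    ... | yes refl | yes refl = inF b

    matching-drivers : ∀ a → loadA x a ≤ 1
    matching-drivers a = begin
      loadA x a
        ≡⟨ cong₂ _+_ (cong₂ _+_ (Σ-cong (λ b → Σ-∧-indicator (does (driver b ≟ a)) (partner b))) (Σ-const-0 {q}))
                     (Σ-const-0 {q}) ⟩
      Σ[ q ] (λ b → ⟦ does (driver b ≟ a) ⟧) + 0 + 0
        ≡⟨ trans (+-identityʳ _) (+-identityʳ _) ⟩
      Σ[ q ] (λ b → ⟦ does (driver b ≟ a) ⟧)
        ≤⟨ Σ-does≤1 (λ b → driver b ≟ a) (λ e e' → driver-injective (trans e (sym e'))) ⟩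
      1 ∎
      where open ≤-Reasoning

    matching-ridersB : ∀ b → loadB x b ≡ 1
    matching-ridersB b = begin
      loadB x b
        ≡⟨ cong₂ _+_ (Σ-cong (λ a → Σ-∧-indicator (does (driver b ≟ a)) (partner b))) (Σ-const-0 {2 * q}) ⟩
      Σ[ 2 * q ] (λ a → ⟦ does (driver b ≟ a) ⟧) + 0
        ≡⟨ +-identityʳ _ ⟩
      Σ[ 2 * q ] (λ a → ⟦ does (driver b ≟ a) ⟧)
        ≡⟨ Σ-does≡1 (driver b ≟_) refl sym ⟩
      1 ∎
      where open ≡-Reasoning

    matching-ridersC : ∀ c → loadC x c ≡ 1
    matching-ridersC c = begin
      loadC x c
        ≡⟨ cong₂ _+_ (Σ-comm (λ a b → ⟦ xT x a b c ⟧)) (Σ-const-0 {2 * q}) ⟩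
      Σ[ q ] (λ b → Σ[ 2 * q ] (λ a → ⟦ xT x a b c ⟧)) + 0
        ≡⟨ +-identityʳ _ ⟩
      Σ[ q ] (λ b → Σ[ 2 * q ] (λ a → ⟦ xT x a b c ⟧))
        ≡⟨ Σ-cong (λ b → Σ-indicator-∧ (driver b) (does (partner b ≟ c))) ⟩
      Σ[ q ] (λ b → ⟦ does (partner b ≟ c) ⟧)
        ≡⟨ Σ-does≡1 (λ b → partner b ≟ c) c-preimage (λ e → partner-injective (trans e (sym c-preimage))) ⟩
      1 ∎
      where
      open ≡-Reasoning
      c-preimage = proj₂ (injective⇒surjective partner-injective c)

    matching-feasible : Feasible x
    matching-feasible = matching-inH , matching-drivers , matching-ridersB , matching-ridersC

    matching-cost : cost x ≡ 2 * q
    matching-cost = begin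
      cost x                        ≡⟨ cong₂ _+_ (cong₂ _+_ (sym (2*triples≡tripleCost x)) (no-pairs wB)) (no-pairs wC) ⟩
      2 * triples x + 0 + 0         ≡⟨ trans (+-identityʳ _) (+-identityʳ _) ⟩
      2 * triples x                 ≡⟨ cong (2 *_) triples≡q ⟩
      2 * q                         ∎
      where
      open ≡-Reasoning
      no-pairs : (w : Fin (2 * q) → Fin q → ℕ) → Σ[ 2 * q ] (λ a → Σ[ q ] (λ r → w a r * 0)) ≡ 0
      no-pairs w = Σ-zero (λ a → Σ-zero (λ r → *-zeroʳ (w a r)))
      pairsB≡0 : pairsB x ≡ 0
      pairsB≡0 = Σ-zero {2 * q} (λ _ → Σ-const-0 {q})
      triples≡q : triples x ≡ q
      triples≡q = begin
        triples x                   ≡⟨ +-identityʳ _ ⟨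
        triples x + 0               ≡⟨ cong (triples x +_) pairsB≡0 ⟨
        triples x + pairsB x        ≡⟨ triples+pairsB≡q x matching-ridersB ⟩
        q                           ∎

  perfect3DM⇒optimal : 2 ≤ ω → HasPerfect3DM q F → OptimalValue (2 * q)
  perfect3DM⇒optimal 2≤ω matching =
    (x , matching-feasible m , matching-cost m) , feasible⇒cost≥2q 2≤ω
    where
    m = perfect3DM⇒matchingByB matching
    x = matchingAssignment m

lemma1 : (q : ℕ) → 1 ≤ q → (ω : ℕ) → 2 ≤ ω → (F : Family q) →
    HasPerfect3DM q F ⇔ ILP.OptimalValue q ω F (2 * q)
lemma1 q _ ω 2≤ω F = mk⇔ (perfect3DM⇒optimal q ω F 2≤ω) (optimal⇒perfect3DM q ω F 2≤ω)
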